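{- There exists a finite bounded graded poset that is CC-shellable but not CL-shellable, and there exists a finite bounded non-graded poset that is CC-shellable but not CL-shellable.
   Context: A poset is bounded if it has a unique minimum $\hat{0}$ and a unique maximum $\hat{1}$; it is graded if all its maximal chains have the same length. $x \lessdot y$ denotes a cover relation. A root of an element $x$ is a maximal chain of $[\hat{0},x]$; a rooted interval $[x,y]_r$ is an interval $[x,y]$ together with a root $r$ of $x$; a rooted cover relation is a rooted interval $[x,u]_r$ with $x\lessdot u$, written $(r,x,u)$. For a chain $r$ and an element $a$, $r\cup a$ means $r\cup\{a\}$. A CE-labeling $\lambda$ of a bounded poset $P$ assigns to each rooted cover relation $(r,x,u)$ an element $\lambda(r,x,u)$ of some poset $\Lambda$. For a rooted interval $[x,y]_r$ and a maximal chain $x=x_0\lessdot x_1\lessdot\cdots\lessdot x_t=y$ of $[x,y]$, its label sequence is $(\lambda(r,x_0,x_1),\lambda(r\cup\{x_1\},x_1,x_2),\dots,\lambda(r\cup\{x_1,\dots,x_{t-1}\},x_{t-1},x_t))$. Label sequences are compared in lexicographic (dictionary) order, where a proper prefix precedes the longer sequence. A CE-labeling is a CL-labeling if for every rooted interval $[x,y]_r$ there is a unique maximal chain of $[x,y]$ whose label sequence is strictly increasing, and its label sequence lexicographically precedes the label sequences of all other maximal chains of $[x,y]_r$; $P$ is CL-shellable if it admits a CL-labeling. A pair of rooted cover relations $(r,u,v)$, $(r\cup\{v\},v,w)$ is a topological ascent if the pair of labels $(\lambda(r,u,v),\lambda(r\cup\{v\},v,w))$ strictly lexicographically precedes the label sequences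 of all other maximal chains of $[u,w]_r$; otherwise it is a topological descent. A maximal chain of $[x,y]_r$ is topologically ascending if every pair of consecutive cover relations in it (with roots extended along the chain) is a topological ascent. A CE-labeling is a CC-labeling if every rooted interval $[x,y]_r$ has a unique topologically ascending maximal chain, the label sequences of the maximal chains of $[x,y]_r$ are pairwise distinct, and no such label sequence is a prefix of another. $P$ is CC-shellable if it admits a CC-labeling. All posets are finite. -}

module Defs where

open import Level using (Level; _⊔_; suc; 0ℓ; Setω)
open import Data.Nat using (ℕ)
open import Data.Fin using (Fin)
open import Data.List using (List; []; _∷_; [_]; _++_; length)
open import Data.List.Relation.Unary.Linked using (Linked)
open import Data.List.Relation.Binary.Lex.Core using (Lex-<)
open import Data.List.Relation.Binary.Pointwise using (Pointwise)
open import Data.List.Relation.Binary.Prefix.Heterogeneous using (Prefix)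
open import Data.Product using (Σ; ∃; _×_; _,_)
open import Data.Unit using (⊤)
open import Relation.Nullary using (¬_)
open import Relation.Binary using (Rel; Decidable; IsPartialOrder)
open import Relation.Binary.Bundles using (Poset)
open import Relation.Binary.PropositionalEquality using (_≡_; _≢_)
import Relation.Binary.Construct.NonStrictToStrict as NS

record BoundedFinPoset : Set₁ where
  field
    n              : ℕ
    _≤_            : Rel (Fin n) 0ℓ
    isPartialOrder : IsPartialOrder _≡_ _≤_
    _≤?_           : Decidable _≤_
    bot            : Fin n
    top            : Fin n
    bot-min        : ∀ x → bot ≤ x
    top-max        : ∀ x → x ≤ top

module _ (P : BoundedFinPoset) where
  open BoundedFinPoset P

  _<ₚ_ : Rel (Fin n) 0ℓ
  x <ₚ y = x ≤ y × x ≢ y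

  _⋖_ : Rel (Fin n) 0ℓ
  x ⋖ y = x <ₚ y × (∀ z → ¬ (x <ₚ z × z <ₚ y))

  data MaxChain : Fin n → Fin n → List (Fin n) → Set where
    single : ∀ {x} → MaxChain x x [ x ]
    cons   : ∀ {x y z c} → x ⋖ y → MaxChain y z c → MaxChain x z (x ∷ c)

  Root : Fin n → List (Fin n) → Set
  Root x r = MaxChain bot x r

  Graded : Set
  Graded = ∀ c c' → MaxChain bot top c → MaxChain bot top c' → length c ≡ length c'

  module Labels {c ℓ₁ ℓ₂ : Level} (Λ : Poset c ℓ₁ ℓ₂) where
    open Poset Λ renaming (Carrier to L; _≈_ to _≈Λ_; _≤_ to _≤Λ_)

    _<Λ_ : Rel L (ℓ₁ ⊔ ℓ₂)
    _<Λ_ = NS._<_ _≈Λ_ _≤Λ_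

    -- strict lexicographic order, proper prefix precedes the longer sequence
    _<lex_ : Rel (List L) (c ⊔ ℓ₁ ⊔ ℓ₂)
    _<lex_ = Lex-< _≈Λ_ _<Λ_

    -- A CE-labeling: a label λ(r,x,u) for each rooted cover relation
    -- (r is the root, a chain listed from 0̂ up to x).  Values on triples
    -- that are not rooted cover relations are irrelevant.
    CELabeling : Set (c ⊔ 0ℓ)
    CELabeling = List (Fin n) → Fin n → Fin n → L

    module _ (λ' : CELabeling) where

      -- label sequence of a chain x₀ x₁ … x_t with root r of x₀;
      -- roots are extended along the chain: r ∪ {x₁} = r ++ [ x₁ ]
      labelSeq : List (Fin n) → List (Fin n) → List L
      labelSeq r (x ∷ y ∷ rest) = λ' r x y ∷ labelSeq (r ++ [ y ]) (y ∷ rest)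
      labelSeq r _              = []

      StrictlyIncreasing : List L → Set (ℓ₁ ⊔ ℓ₂ ⊔ c)
      StrictlyIncreasing = Linked _<Λ_

      IsCLLabeling : Set (c ⊔ ℓ₁ ⊔ ℓ₂)
      IsCLLabeling =
        ∀ x y r → x ≤ y → Root x r →
        Σ (List (Fin n)) λ m →
          (MaxChain x y m × StrictlyIncreasing (labelSeq r m))
          × (∀ m' → MaxChain x y m' → StrictlyIncreasing (labelSeq r m') → m' ≡ m)
          × (∀ m' → MaxChain x y m' → m' ≢ m → labelSeq r m <lex labelSeq r m')

      TopAscent : List (Fin n) → Fin n → Fin n → Fin n → Set (c ⊔ ℓ₁ ⊔ ℓ₂)
      TopAscent r u v w =
        ∀ m' → MaxChain u w m' → m' ≢ (u ∷ v ∷ w ∷ []) →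
          (λ' r u v ∷ λ' (r ++ [ v ]) v w ∷ []) <lex labelSeq r m'

      TopAscending : List (Fin n) → List (Fin n) → Set (c ⊔ ℓ₁ ⊔ ℓ₂)
      TopAscending r (x ∷ y ∷ z ∷ rest) =
        TopAscent r x y z × TopAscending (r ++ [ y ]) (y ∷ z ∷ rest)
      TopAscending r _ = Level.Lift _ ⊤

      IsCCLabeling : Set (c ⊔ ℓ₁ ⊔ ℓ₂)
      IsCCLabeling =
        ∀ x y r → x ≤ y → Root x r →
        (Σ (List (Fin n)) λ m →
          (MaxChain x y m × TopAscending r m)
          × (∀ m' → MaxChain x y m' → TopAscending r m' → m' ≡ m))
        × (∀ m m' → MaxChain x y m → MaxChain x y m' → m ≢ m' →
             ¬ Pointwise _≈Λ_ (labelSeq r m) (labelSeq r m')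
             × ¬ Prefix _≈Λ_ (labelSeq r m) (labelSeq r m'))

  CLShellable : (c ℓ₁ ℓ₂ : Level) → Set (suc (c ⊔ ℓ₁ ⊔ ℓ₂))
  CLShellable c ℓ₁ ℓ₂ =
    Σ (Poset c ℓ₁ ℓ₂) λ Λ → Σ (Labels.CELabeling Λ) λ λ' → Labels.IsCLLabeling Λ λ'

  CCShellable : (c ℓ₁ ℓ₂ : Level) → Set (suc (c ⊔ ℓ₁ ⊔ ℓ₂))
  CCShellable c ℓ₁ ℓ₂ =
    Σ (Poset c ℓ₁ ℓ₂) λ Λ → Σ (Labels.CELabeling Λ) λ λ' → Labels.IsCCLabeling Λ λ'

  NotCLShellable : Setω
  NotCLShellable = ∀ c ℓ₁ ℓ₂ → ¬ CLShellable c ℓ₁ ℓ₂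

-- Existence packaging at Setω (needed because "not CL-shellable"
-- quantifies over label posets of all universe levels).

record CCnotCL (Cond : BoundedFinPoset → Set) : Setω where
  field
    poset       : BoundedFinPoset
    cond        : Cond poset
    ccShellable : CCShellable poset 0ℓ 0ℓ 0ℓ
    notCL       : NotCLShellable poset

record _×ω_ (A B : Setω) : Setω where
  constructor _,ω_
  field
    fstω : A
    sndω : B

module Submission where

-- Both posets are shown CC-shellable by exhaustively checking an explicit ℕ-valued labeling,
-- enumerating maximal chains along the Hasse diagram. Against CL-shellability we use two
-- consequences of the CL axioms: an interval with a single maximal chain has that chain
-- increasing, and the increasing chain of an interval is lexicographically first.
-- In the graded poset each of e₀, …, e₃ covers two of the atoms a, b, c, and [0̂,eᵢ] is "won"
-- by the atom with the smaller first label, whose chain is increasing; however the four wins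
-- are distributed, one of y₀, y₁, y₂ receives two increasing maximal chains.
-- In the non-graded poset the pentagons [0̂,7] and [0̂,5] have long sides starting at
-- different atoms, and comparing the first labels in both intervals is contradictory.

open import Defs
open import Relation.Nullary using (¬_)

open import Level using (Level; 0ℓ; _⊔_; lift)
open import Data.Nat as ℕ using (ℕ; zero; suc; s≤s; _∸_)
import Data.Nat.Properties as ℕ
open import Data.Fin using (Fin; toℕ; #_)
open import Data.Fin.Properties using (all?; _≟_; toℕ<n)
open import Data.List using (List; []; _∷_; [_]; _++_; length; map; concatMap; filter; allFin)
open import Data.List.Properties using (∷-injectiveˡ; ∷-injectiveʳ) renaming (≡-dec to List-≟)
open import Data.List.Membership.Propositional using (_∈_; find; lose)
open import Data.List.Membership.Propositional.Properties
  using (∈-++⁺ˡ; ∈-++⁺ʳ; ∈-++⁻; ∈-map⁺; ∈-map⁻; ∈-concatMap⁺; ∈-concatMap⁻)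
import Data.List.Membership.DecPropositional as DecMembership
open import Data.List.Relation.Unary.Any using (here; there)
import Data.List.Relation.Unary.All as All
import Data.List.Relation.Unary.Any as Any
open import Data.List.Relation.Unary.Linked using ([-]; _∷_)
import Data.List.Relation.Unary.Linked as Linked
open import Data.List.Relation.Binary.Lex.Strict using (this; next; base; <-decidable)
open import Data.List.Relation.Binary.Pointwise using (Pointwise)
open import Data.List.Relation.Binary.Prefix.Heterogeneous using (Prefix)
open import Data.List.Relation.Binary.Pointwise.Properties using () renaming (decidable to Pointwise-dec)
open import Data.List.Relation.Binary.Prefix.Heterogeneous.Properties using (prefix?)
open import Data.Product using (Σ; ∃; _×_; _,_; proj₁; proj₂)
open import Data.Sum using (_⊎_; inj₁; inj₂)
open import Data.Empty using (⊥; ⊥-elim)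
open import Data.Unit using (tt)
open import Function using (_∘_)
open import Relation.Nullary using (Dec; yes; no; ¬?; contradiction)
open import Relation.Nullary.Decidable using (True; toWitness; from-yes; from-no; map′; _×-dec_; _→-dec_)
open import Relation.Binary using (Rel; Decidable; IsPartialOrder)
open import Relation.Binary.Bundles using (Poset)
open import Relation.Binary.PropositionalEquality using (_≡_; _≢_; refl; sym; trans; isEquivalence)
import Relation.Binary.Construct.NonStrictToStrict as NS
import Relation.Binary.Properties.Poset as PosetProperties

module _ (P : BoundedFinPoset) where
  open BoundedFinPoset P

  MaxChain⇒≤ : ∀ {x y c} → MaxChain P x y c → x ≤ y
  MaxChain⇒≤ single                     = IsPartialOrder.refl isPartialOrder
  MaxChain⇒≤ (cons ((x≤u , _) , _) mc) = IsPartialOrder.trans isPartialOrder x≤u (MaxChain⇒≤ mc)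

  MaxChain-head-⋖ : ∀ {x y u c} → MaxChain P x y (x ∷ u ∷ c) → _⋖_ P x u
  MaxChain-head-⋖ (cons x⋖u single)     = x⋖u
  MaxChain-head-⋖ (cons x⋖u (cons _ _)) = x⋖u

  MaxChain-extend : ∀ {x y z c} → MaxChain P x y c → _⋖_ P y z → MaxChain P x z (c ++ [ z ])
  MaxChain-extend single        y⋖z = cons y⋖z single
  MaxChain-extend (cons x⋖u mc) y⋖z = cons x⋖u (MaxChain-extend mc y⋖z)

  MaxChainsAre : Fin n → Fin n → List (List (Fin n)) → Set
  MaxChainsAre x y ms = (∀ {m} → m ∈ ms → MaxChain P x y m) × (∀ {m} → MaxChain P x y m → m ∈ ms)

  _<?_ : Decidable (_<ₚ_ P)
  x <? y = x ≤? y ×-dec ¬? (x ≟ y)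

  _⋖?_ : Decidable (_⋖_ P)
  x ⋖? y = x <? y ×-dec all? λ z → ¬? (x <? z ×-dec z <? y)

module CLLabelingProperties (P : BoundedFinPoset) {c ℓ₁ ℓ₂ : Level} (Λ : Poset c ℓ₁ ℓ₂)
  (λ' : Labels.CELabeling P Λ) (cl : Labels.IsCLLabeling P Λ λ') where
  open BoundedFinPoset P using (n)
  open Poset Λ using (module Eq) renaming (Carrier to L; _≈_ to _≈Λ_)
  open Labels P Λ
  open PosetProperties Λ using (<-trans; <-irrefl; <-asym; <-respˡ-≈)

  labels : List (Fin n) → List (Fin n) → List L
  labels = labelSeq λ'

  Increasing : List L → Set (c ⊔ ℓ₁ ⊔ ℓ₂)
  Increasing = StrictlyIncreasing λ'

  Ascent : List (Fin n) → Fin n → Fin n → Fin n → Set (ℓ₁ ⊔ ℓ₂)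
  Ascent r x u e = λ' r x u <Λ λ' (r ++ [ u ]) u e

  Beats : List (Fin n) → Fin n → Fin n → Fin n → Fin n → Set (ℓ₁ ⊔ ℓ₂)
  Beats r x u u' y = λ' r x u <Λ λ' r x u' × Ascent r x u y

  lex-∷⁻ : ∀ {a b as bs} → (a ∷ as) <lex (b ∷ bs) → a <Λ b ⊎ (a ≈Λ b × as <lex bs)
  lex-∷⁻ (this a<b)       = inj₁ a<b
  lex-∷⁻ (next a≈b as<bs) = inj₂ (a≈b , as<bs)

  increasing-unique : ∀ {x y r m m'} → Root P x r → MaxChain P x y m → MaxChain P x y m' →
                      Increasing (labels r m) → Increasing (labels r m') → m ≡ m'
  increasing-unique root mc mc' inc inc' with cl _ _ _ (MaxChain⇒≤ P mc) root
  ... | _ , _ , unique , _ = trans (unique _ mc inc) (sym (unique _ mc' inc'))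

  increasing-lex-least : ∀ {x y r m m'} → Root P x r → MaxChain P x y m → Increasing (labels r m) →
                         MaxChain P x y m' → m' ≢ m → labels r m <lex labels r m'
  increasing-lex-least root mc inc mc' m'≢m with cl _ _ _ (MaxChain⇒≤ P mc) root
  ... | _ , _ , unique , least with unique _ mc inc
  ... | refl = least _ mc' m'≢m

  only-chain-increasing : ∀ {x y r m} → Root P x r → MaxChainsAre P x y [ m ] → Increasing (labels r m)
  only-chain-increasing root (only , all) with cl _ _ _ (MaxChain⇒≤ P (only (here refl))) root
  ... | _ , (mc , inc) , _ with all mc
  ... | here refl = inc

  ascent-into-only-chain : ∀ {x u e y r m} → Root P x r → _⋖_ P x u →
                           MaxChainsAre P u y [ u ∷ e ∷ m ] → Ascent r x u e →
                           Increasing (labels r (x ∷ u ∷ e ∷ m))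
  ascent-into-only-chain root x⋖u only x↑u =
    x↑u ∷ only-chain-increasing (MaxChain-extend P root x⋖u) only

  ascents-into-only-chains-agree : ∀ {x u e v f y r m m'} → Root P x r → _⋖_ P x u → _⋖_ P x v →
                                   MaxChainsAre P u y [ u ∷ e ∷ m ] → MaxChainsAre P v y [ v ∷ f ∷ m' ] →
                                   Ascent r x u e → Ascent r x v f → u ≡ v
  ascents-into-only-chains-agree root x⋖u x⋖v only-u only-v x↑u x↑v =
    ∷-injectiveˡ (∷-injectiveʳ
      (increasing-unique root (cons x⋖u (proj₁ only-u (here refl))) (cons x⋖v (proj₁ only-v (here refl)))
        (ascent-into-only-chain root x⋖u only-u x↑u) (ascent-into-only-chain root x⋖v only-v x↑v)))

  increasing-rank-two-beats : ∀ {x u u' y r} → Root P x r → u ≢ u' →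
                              MaxChain P x y (x ∷ u ∷ y ∷ []) → MaxChain P x y (x ∷ u' ∷ y ∷ []) →
                              Increasing (labels r (x ∷ u ∷ y ∷ [])) → Beats r x u u' y
  increasing-rank-two-beats root u≢u' mc mc' inc@(x↑u ∷ [-])
    with lex-∷⁻ (increasing-lex-least root mc inc mc' (u≢u' ∘ sym ∘ ∷-injectiveˡ ∘ ∷-injectiveʳ))
  ... | inj₁ first<        = first< , x↑u
  ... | inj₂ (_ , next _ (base ()))
  -- equal first labels would make the chain through u' increasing as well
  ... | inj₂ (first≈ , this second<) =
    ⊥-elim (u≢u' (∷-injectiveˡ (∷-injectiveʳ
      (increasing-unique root mc mc' inc (<-respˡ-≈ first≈ (<-trans x↑u second<) ∷ [-])))))

  rank-two-winner : ∀ {x u u' y r} → Root P x r → u ≢ u' →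
                    MaxChainsAre P x y ((x ∷ u ∷ y ∷ []) ∷ (x ∷ u' ∷ y ∷ []) ∷ []) →
                    Beats r x u u' y ⊎ Beats r x u' u y
  rank-two-winner root u≢u' (two , all) with cl _ _ _ (MaxChain⇒≤ P (two (here refl))) root
  ... | _ , (mc , inc) , _ with all mc
  ... | here refl         = inj₁ (increasing-rank-two-beats root u≢u' mc (two (there (here refl))) inc)
  ... | there (here refl) = inj₂ (increasing-rank-two-beats root (u≢u' ∘ sym) mc (two (here refl)) inc)

  crossed-pentagons : ∀ {x x₁ x₂ x₃ x₄ x₅ x₇ r} → Root P x r → _⋖_ P x₁ x₅ → _⋖_ P x₃ x₇ →
                      MaxChainsAre P x x₂ [ x ∷ x₁ ∷ x₂ ∷ [] ] → MaxChainsAre P x₁ x₇ [ x₁ ∷ x₂ ∷ x₇ ∷ [] ] →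
                      MaxChainsAre P x x₄ [ x ∷ x₃ ∷ x₄ ∷ [] ] → MaxChainsAre P x₃ x₅ [ x₃ ∷ x₄ ∷ x₅ ∷ [] ] → ⊥
  crossed-pentagons {x} {x₁} {x₂} {x₃} {x₄} {x₅} {x₇} {r} root x₁⋖x₅ x₃⋖x₇ only₂ only₇ only₄ only₅ =
    compare (lex-∷⁻ lex₇) (lex-∷⁻ lex₅)
    where
    x⋖x₁ : _⋖_ P x x₁
    x⋖x₁ = MaxChain-head-⋖ P (proj₁ only₂ (here refl))

    x⋖x₃ : _⋖_ P x x₃
    x⋖x₃ = MaxChain-head-⋖ P (proj₁ only₄ (here refl))

    x↑x₃ : Ascent r x x₃ x₄
    x↑x₃ = Linked.head (only-chain-increasing root only₄)

    short₅ : MaxChain P x x₅ (x ∷ x₁ ∷ x₅ ∷ [])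
    short₅ = cons x⋖x₁ (cons x₁⋖x₅ single)

    long₅ : MaxChain P x x₅ (x ∷ x₃ ∷ x₄ ∷ x₅ ∷ [])
    long₅ = cons x⋖x₃ (proj₁ only₅ (here refl))

    long₅↑ : Increasing (labels r (x ∷ x₃ ∷ x₄ ∷ x₅ ∷ []))
    long₅↑ = ascent-into-only-chain root x⋖x₃ only₅ x↑x₃

    lex₇ : labels r (x ∷ x₁ ∷ x₂ ∷ x₇ ∷ []) <lex labels r (x ∷ x₃ ∷ x₇ ∷ [])
    lex₇ = increasing-lex-least root (cons x⋖x₁ (proj₁ only₇ (here refl)))
             (ascent-into-only-chain root x⋖x₁ only₇ (Linked.head (only-chain-increasing root only₂)))
             (cons x⋖x₃ (cons x₃⋖x₇ single)) (λ ())

    lex₅ : labels r (x ∷ x₃ ∷ x₄ ∷ x₅ ∷ []) <lex labels r (x ∷ x₁ ∷ x₅ ∷ [])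
    lex₅ = increasing-lex-least root long₅ long₅↑ short₅ (λ ())

    A B : L
    A = λ' r x x₁
    B = λ' r x x₃

    -- in the last case A ≈ B < λ(r ∪ x₃, x₃, x₄) < λ(r ∪ x₁, x₁, x₅), so the short side of [x,x₅] increases too
    compare : A <Λ B ⊎ (A ≈Λ B × _) →
              B <Λ A ⊎ (B ≈Λ A × labels (r ++ [ x₃ ]) (x₃ ∷ x₄ ∷ x₅ ∷ []) <lex labels (r ++ [ x₁ ]) (x₁ ∷ x₅ ∷ [])) →
              ⊥
    compare (inj₁ A<B)       (inj₁ B<A)       = <-asym A<B B<A
    compare (inj₁ A<B)       (inj₂ (B≈A , _)) = <-irrefl (Eq.sym B≈A) A<B
    compare (inj₂ (A≈B , _)) (inj₁ B<A)       = <-irrefl (Eq.sym A≈B) B<A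
    compare (inj₂ _)         (inj₂ (B≈A , rest)) with lex-∷⁻ rest
    ... | inj₂ (_ , ())
    ... | inj₁ x₃↑<x₁↑ =
      contradiction (increasing-unique root short₅ long₅ (<-respˡ-≈ B≈A (<-trans x↑x₃ x₃↑<x₁↑) ∷ [-]) long₅↑) λ ()

record CoverEnumeration (P : BoundedFinPoset) : Set where
  open BoundedFinPoset P
  field
    covers            : Fin n → List (Fin n)
    covers-sound      : ∀ x z → z ∈ covers x → _⋖_ P x z
    covers-complete   : ∀ x z → _⋖_ P x z → z ∈ covers x
    height            : Fin n → ℕ
    height-decreasing : ∀ x z → _⋖_ P x z → height z ℕ.< height x

module MaxChainEnumeration (P : BoundedFinPoset) (E : CoverEnumeration P) where
  open BoundedFinPoset P
  open CoverEnumeration E renaming (height to h; height-decreasing to h-decreasing)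

  trivialChain : Fin n → Fin n → List (List (Fin n))
  trivialChain x y with x ≟ y
  ... | yes _ = [ [ x ] ]
  ... | no _  = []

  chainsWithin : ℕ → Fin n → Fin n → List (List (Fin n))
  chainsWithin zero    x y = []
  chainsWithin (suc k) x y = trivialChain x y ++ concatMap (λ z → map (x ∷_) (chainsWithin k z y)) (covers x)

  ∈-trivialChain⁻ : ∀ {x y c} → c ∈ trivialChain x y → MaxChain P x y c
  ∈-trivialChain⁻ {x} {y} c∈ with x ≟ y
  ∈-trivialChain⁻ (here refl) | yes refl = single

  ∈-trivialChain⁺ : ∀ x → [ x ] ∈ trivialChain x x
  ∈-trivialChain⁺ x with x ≟ x
  ... | yes _   = here refl
  ... | no x≢x = ⊥-elim (x≢x refl)

  ∈-chainsWithin⁻ : ∀ k {x y c} → c ∈ chainsWithin k x y → MaxChain P x y c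
  ∈-chainsWithin⁻ (suc k) {x} {y} c∈ with ∈-++⁻ (trivialChain x y) c∈
  ... | inj₁ c∈₀ = ∈-trivialChain⁻ c∈₀
  ... | inj₂ c∈₁ with find (∈-concatMap⁻ (λ z → map (x ∷_) (chainsWithin k z y)) {xs = covers x} c∈₁)
  ... | z , z∈ , c∈₂ with ∈-map⁻ (x ∷_) c∈₂
  ... | d , d∈ , refl = cons (covers-sound x z z∈) (∈-chainsWithin⁻ k d∈)

  ∈-chainsWithin⁺ : ∀ k {x y c} → MaxChain P x y c → h x ℕ.< k → c ∈ chainsWithin k x y
  ∈-chainsWithin⁺ (suc k) {x} single _ = ∈-++⁺ˡ (∈-trivialChain⁺ x)
  ∈-chainsWithin⁺ (suc k) {x} {y} (cons {y = z} x⋖z mc) (s≤s hx≤k) =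
    ∈-++⁺ʳ (trivialChain x y)
      (∈-concatMap⁺ (λ z → map (x ∷_) (chainsWithin k z y))
        (lose (covers-complete x z x⋖z)
              (∈-map⁺ (x ∷_) (∈-chainsWithin⁺ k mc (ℕ.<-≤-trans (h-decreasing x z x⋖z) hx≤k)))))

  maxChains : Fin n → Fin n → List (List (Fin n))
  maxChains x y = chainsWithin (suc (h x)) x y

  ∈-maxChains⁻ : ∀ {x y c} → c ∈ maxChains x y → MaxChain P x y c
  ∈-maxChains⁻ {x} = ∈-chainsWithin⁻ (suc (h x))

  ∈-maxChains⁺ : ∀ {x y c} → MaxChain P x y c → c ∈ maxChains x y
  ∈-maxChains⁺ {x} mc = ∈-chainsWithin⁺ (suc (h x)) mc ℕ.≤-refl

  module _ {q : Level} {Q : List (Fin n) → Set q} (Q? : ∀ c → Dec (Q c)) where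

    allMaxChains? : ∀ x y → Dec (∀ c → MaxChain P x y c → Q c)
    allMaxChains? x y =
      map′ (λ all c mc → All.lookup all (∈-maxChains⁺ mc))
           (λ all → All.tabulate (λ c∈ → all _ (∈-maxChains⁻ c∈)))
           (All.all? Q? (maxChains x y))

    anyMaxChain? : ∀ x y → Dec (∃ λ c → MaxChain P x y c × Q c)
    anyMaxChain? x y =
      map′ (λ any → let c , c∈ , q = find any in c , ∈-maxChains⁻ c∈ , q)
           (λ (c , mc , q) → lose (∈-maxChains⁺ mc) q)
           (Any.any? Q? (maxChains x y))

  _≟ₗ_ : (c c' : List (Fin n)) → Dec (c ≡ c')
  _≟ₗ_ = List-≟ _≟_

  open DecMembership _≟ₗ_ using (_∈?_)

  maxChain? : ∀ x y c → Dec (MaxChain P x y c)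
  maxChain? x y c = map′ ∈-maxChains⁻ ∈-maxChains⁺ (c ∈? maxChains x y)

  maxChainsAre? : ∀ x y ms → Dec (MaxChainsAre P x y ms)
  maxChainsAre? x y ms =
    map′ (λ (sound , complete) → All.lookup sound , λ {m} mc → complete m mc)
         (λ (sound , complete) → All.tabulate sound , λ m mc → complete mc)
         (All.all? (maxChain? x y) ms ×-dec allMaxChains? (_∈? ms) x y)

  graded? : Dec (Graded P)
  graded? =
    map′ (λ all c c' mc mc' → all c mc c' mc') (λ graded c mc c' mc' → graded c c' mc mc')
         (allMaxChains? (λ c → allMaxChains? (λ c' → length c ℕ.≟ length c') bot top) bot top)

module CCLabelingDecision (P : BoundedFinPoset) (E : CoverEnumeration P)
  {c ℓ₁ ℓ₂ : Level} (Λ : Poset c ℓ₁ ℓ₂)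
  (_≟Λ_ : Decidable (Poset._≈_ Λ)) (_≤Λ?_ : Decidable (Poset._≤_ Λ)) where
  open BoundedFinPoset P using (n; bot; _≤?_)
  open Poset Λ using () renaming (_≈_ to _≈Λ_; _≤_ to _≤Λ_)
  open Labels P Λ
  open MaxChainEnumeration P E

  _<lex?_ : Decidable _<lex_
  _<lex?_ = <-decidable _≟Λ_ (NS.<-decidable _≈Λ_ _≤Λ_ _≟Λ_ _≤Λ?_)

  module _ (λ' : CELabeling) where

    topAscent? : ∀ r u v w → Dec (TopAscent λ' r u v w)
    topAscent? r u v w =
      allMaxChains? (λ m → ¬? (m ≟ₗ (u ∷ v ∷ w ∷ [])) →-dec
                           ((λ' r u v ∷ λ' (r ++ [ v ]) v w ∷ []) <lex? labelSeq λ' r m)) u w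

    topAscending? : ∀ r m → Dec (TopAscending λ' r m)
    topAscending? r []                = yes (lift tt)
    topAscending? r (_ ∷ [])          = yes (lift tt)
    topAscending? r (_ ∷ _ ∷ [])      = yes (lift tt)
    topAscending? r (x ∷ y ∷ z ∷ m) = topAscent? r x y z ×-dec topAscending? (r ++ [ y ]) (y ∷ z ∷ m)

    uniqueTopAscending? : ∀ x y r → Dec (Σ (List (Fin n)) λ m →
                            (MaxChain P x y m × TopAscending λ' r m)
                            × (∀ m' → MaxChain P x y m' → TopAscending λ' r m' → m' ≡ m))
    uniqueTopAscending? x y r =
      map′ (λ (m , mc , ta , unique) → m , (mc , ta) , unique)
           (λ (m , (mc , ta) , unique) → m , mc , ta , unique)
           (anyMaxChain? (λ m → topAscending? r m ×-dec
                                allMaxChains? (λ m' → topAscending? r m' →-dec (m' ≟ₗ m)) x y) x y)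

    distinctLabelSeqs? : ∀ x y r → Dec (∀ m m' → MaxChain P x y m → MaxChain P x y m' → m ≢ m' →
                            ¬ Pointwise _≈Λ_ (labelSeq λ' r m) (labelSeq λ' r m')
                            × ¬ Prefix _≈Λ_ (labelSeq λ' r m) (labelSeq λ' r m'))
    distinctLabelSeqs? x y r =
      map′ (λ all m m' mc mc' → all m mc m' mc') (λ all m mc m' mc' → all m m' mc mc')
        (allMaxChains? (λ m → allMaxChains? (λ m' → ¬? (m ≟ₗ m') →-dec
            (¬? (Pointwise-dec _≟Λ_ (labelSeq λ' r m) (labelSeq λ' r m'))
             ×-dec ¬? (prefix? _≟Λ_ (labelSeq λ' r m) (labelSeq λ' r m')))) x y) x y)

    isCCLabeling? : Dec (IsCCLabeling λ')
    isCCLabeling? =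
      map′ (λ all x y r x≤y root → all x y x≤y r root) (λ cc x y x≤y r root → cc x y r x≤y root)
        (all? λ x → all? λ y → (x ≤? y) →-dec
           allMaxChains? (λ r → uniqueTopAscending? x y r ×-dec distinctLabelSeqs? x y r) bot x)

module _ {n : ℕ} {_≼_ : Rel (Fin n) 0ℓ} (_≼?_ : Decidable _≼_) where

  reflexive? : Dec (∀ x → x ≼ x)
  reflexive? = all? λ x → x ≼? x

  transitive? : Dec (∀ x y z → x ≼ y → y ≼ z → x ≼ z)
  transitive? = all? λ x → all? λ y → all? λ z → (x ≼? y) →-dec ((y ≼? z) →-dec (x ≼? z))

  antisymmetric? : Dec (∀ x y → x ≼ y → y ≼ x → x ≡ y)
  antisymmetric? = all? λ x → all? λ y → (x ≼? y) →-dec ((y ≼? x) →-dec (x ≟ y))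

  decidedBoundedFinPoset : (bot top : Fin n) →
                           {True reflexive?} → {True transitive?} → {True antisymmetric?} →
                           {True (all? λ x → bot ≼? x)} → {True (all? λ x → x ≼? top)} → BoundedFinPoset
  decidedBoundedFinPoset bot top {refl?} {trans?} {antisym?} {min?} {max?} = record
    { n              = n
    ; _≤_            = _≼_
    ; isPartialOrder = record
      { isPreorder = record
        { isEquivalence = isEquivalence
        ; reflexive     = λ { {x} refl → toWitness refl? x }
        ; trans         = λ {x} {y} {z} → toWitness trans? x y z }
      ; antisym = λ {x} {y} → toWitness antisym? x y }
    ; _≤?_    = _≼?_
    ; bot     = bot
    ; top     = top
    ; bot-min = toWitness min?
    ; top-max = toWitness max? }

UpSetOrder : (n : ℕ) → (ℕ → List ℕ) → Rel (Fin n) 0ℓ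
UpSetOrder n up x y = toℕ y ∈ up (toℕ x)

upSetOrder? : (n : ℕ) (up : ℕ → List ℕ) → Decidable (UpSetOrder n up)
upSetOrder? n up x y = toℕ y ∈? up (toℕ x)
  where open DecMembership ℕ._≟_ using (_∈?_)

module _ (P : BoundedFinPoset) (table : ℕ → List ℕ) where
  open BoundedFinPoset P using (n)
  open DecMembership ℕ._≟_ using () renaming (_∈?_ to _∈ℕ?_)
  open DecMembership (_≟_ {n}) using (_∈?_)

  tabulated : Fin n → List (Fin n)
  tabulated x = filter (λ z → toℕ z ∈ℕ? table (toℕ x)) (allFin n)

  -- when the covers raise the index, n ∸ index is a height function
  tabulatedCoverEnumeration :
    {True (all? λ x → all? λ z → (z ∈? tabulated x) →-dec (_⋖?_ P x z))} →
    {True (all? λ x → all? λ z → (_⋖?_ P x z) →-dec (z ∈? tabulated x))} →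
    {True (all? λ x → all? λ z → (_⋖?_ P x z) →-dec (toℕ x ℕ.<? toℕ z))} →
    CoverEnumeration P
  tabulatedCoverEnumeration {sound} {complete} {raise} = record
    { covers            = tabulated
    ; covers-sound      = toWitness sound
    ; covers-complete   = toWitness complete
    ; height            = λ x → n ∸ toℕ x
    ; height-decreasing = λ x z x⋖z → ℕ.∸-monoʳ-< (toWitness raise x z x⋖z) (ℕ.<⇒≤ (toℕ<n z))
    }

module GradedExample where

  up : ℕ → List ℕ
  up 0  = 0 ∷ 1 ∷ 2 ∷ 3 ∷ 4 ∷ 5 ∷ 6 ∷ 7 ∷ 8 ∷ 9 ∷ 10 ∷ 11 ∷ 12 ∷ []
  up 1  = 1 ∷ 4 ∷ 5 ∷ 6 ∷ 8 ∷ 9 ∷ 10 ∷ 11 ∷ 12 ∷ []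
  up 2  = 2 ∷ 4 ∷ 5 ∷ 7 ∷ 8 ∷ 9 ∷ 10 ∷ 11 ∷ 12 ∷ []
  up 3  = 3 ∷ 6 ∷ 7 ∷ 8 ∷ 9 ∷ 10 ∷ 11 ∷ 12 ∷ []
  up 4  = 4 ∷ 8 ∷ 11 ∷ 12 ∷ []
  up 5  = 5 ∷ 9 ∷ 11 ∷ 12 ∷ []
  up 6  = 6 ∷ 8 ∷ 10 ∷ 11 ∷ 12 ∷ []
  up 7  = 7 ∷ 9 ∷ 10 ∷ 11 ∷ 12 ∷ []
  up 8  = 8 ∷ 12 ∷ []
  up 9  = 9 ∷ 12 ∷ []
  up 10 = 10 ∷ 12 ∷ []
  up 11 = 11 ∷ 12 ∷ []
  up _  = 12 ∷ []

  poset : BoundedFinPoset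
  poset = decidedBoundedFinPoset (upSetOrder? 13 up) (# 0) (# 12)

  coverTable : ℕ → List ℕ
  coverTable 0 = 1 ∷ 2 ∷ 3 ∷ []
  coverTable 1 = 4 ∷ 5 ∷ 6 ∷ []
  coverTable 2 = 4 ∷ 5 ∷ 7 ∷ []
  coverTable 3 = 6 ∷ 7 ∷ []
  coverTable 4 = 8 ∷ 11 ∷ []
  coverTable 5 = 9 ∷ 11 ∷ []
  coverTable 6 = 8 ∷ 10 ∷ 11 ∷ []
  coverTable 7 = 9 ∷ 10 ∷ 11 ∷ []
  coverTable 8 = 12 ∷ []
  coverTable 9 = 12 ∷ []
  coverTable 10 = 12 ∷ []
  coverTable 11 = 12 ∷ []
  coverTable _ = []

  enumeration : CoverEnumeration poset
  enumeration = tabulatedCoverEnumeration poset coverTable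

  open MaxChainEnumeration poset enumeration

  coverLabel : ℕ → ℕ → ℕ
  coverLabel 1 4  = 0
  coverLabel 2 4  = 1
  coverLabel 1 5  = 7
  coverLabel 2 5  = 6
  coverLabel 1 6  = 2
  coverLabel 3 6  = 3
  coverLabel 2 7  = 5
  coverLabel 3 7  = 4
  coverLabel 4 8  = 1
  coverLabel 5 9  = 2
  coverLabel 6 8  = 1
  coverLabel 6 10 = 3
  coverLabel 7 9  = 2
  coverLabel 7 10 = 3
  coverLabel _ _  = 0

  labeling : List (Fin 13) → Fin 13 → Fin 13 → ℕ
  labeling _ u v = coverLabel (toℕ u) (toℕ v)

  ccShellable : CCShellable poset 0ℓ 0ℓ 0ℓ
  ccShellable = ℕ.≤-poset , labeling ,
    from-yes (CCLabelingDecision.isCCLabeling? poset enumeration ℕ.≤-poset ℕ._≟_ ℕ._≤?_ labeling)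

  graded : Graded poset
  graded = from-yes graded?

  0̂ a b c e₀ e₁ e₂ e₃ y₀ y₁ y₂ : Fin 13
  0̂  = # 0
  a  = # 1
  b  = # 2
  c  = # 3
  e₀ = # 4
  e₁ = # 5
  e₂ = # 6
  e₃ = # 7
  y₀ = # 8
  y₁ = # 9
  y₂ = # 10

  notCLShellable : NotCLShellable poset
  notCLShellable _ ℓ₁ ℓ₂ (Λ , λ' , cl) = tournament (winner a b e₀) (winner a b e₁) (winner a c e₂) (winner b c e₃)
    where
    open CLLabelingProperties poset Λ λ' cl
    open PosetProperties Λ using (<-trans; <-asym)

    Duel : Fin 13 → Fin 13 → Fin 13 → Set (ℓ₁ ⊔ ℓ₂)
    Duel u u' e = Beats [ 0̂ ] 0̂ u u' e ⊎ Beats [ 0̂ ] 0̂ u' u e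

    winner : ∀ u u' e {u≢u' : True (¬? (u ≟ u'))}
             {two : True (maxChainsAre? 0̂ e ((0̂ ∷ u ∷ e ∷ []) ∷ (0̂ ∷ u' ∷ e ∷ []) ∷ []))} →
             Duel u u' e
    winner u u' e {u≢u'} {two} = rank-two-winner single (toWitness u≢u') (toWitness two)

    agree : ∀ u e v f y {0̂⋖u : True (_⋖?_ poset 0̂ u)} {0̂⋖v : True (_⋖?_ poset 0̂ v)}
            {only-u : True (maxChainsAre? u y [ u ∷ e ∷ y ∷ [] ])}
            {only-v : True (maxChainsAre? v y [ v ∷ f ∷ y ∷ [] ])} →
            Ascent [ 0̂ ] 0̂ u e → Ascent [ 0̂ ] 0̂ v f → u ≡ v
    agree u e v f y {0̂⋖u} {0̂⋖v} {only-u} {only-v} =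
      ascents-into-only-chains-agree single (toWitness 0̂⋖u) (toWitness 0̂⋖v) (toWitness only-u) (toWitness only-v)

    y₀-blocks : Ascent [ 0̂ ] 0̂ b e₀ → Ascent [ 0̂ ] 0̂ c e₂ → ⊥
    y₀-blocks b↑ c↑ = contradiction (agree b e₀ c e₂ y₀ b↑ c↑) λ ()

    y₁-blocks : Ascent [ 0̂ ] 0̂ a e₁ → Ascent [ 0̂ ] 0̂ c e₃ → ⊥
    y₁-blocks a↑ c↑ = contradiction (agree a e₁ c e₃ y₁ a↑ c↑) λ ()

    y₂-blocks : Ascent [ 0̂ ] 0̂ a e₂ → Ascent [ 0̂ ] 0̂ b e₃ → ⊥
    y₂-blocks a↑ b↑ = contradiction (agree a e₂ b e₃ y₂ a↑ b↑) λ ()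

    tournament : Duel a b e₀ → Duel a b e₁ → Duel a c e₂ → Duel b c e₃ → ⊥
    tournament (inj₂ (_ , b↑e₀))   _               (inj₂ (_ , c↑e₂))   _                 = y₀-blocks b↑e₀ c↑e₂
    tournament (inj₂ _)            _               (inj₁ (_ , a↑e₂))   (inj₁ (_ , b↑e₃)) = y₂-blocks a↑e₂ b↑e₃
    tournament (inj₂ (b<a , _))    _               (inj₁ (a<c , _))    (inj₂ (c<b , _))  = <-asym (<-trans b<a a<c) c<b
    tournament (inj₁ (a<b , _))    (inj₂ (b<a , _)) _                  _                 = <-asym a<b b<a
    tournament (inj₁ _)            (inj₁ (_ , a↑e₁)) (inj₂ _)          (inj₂ (_ , c↑e₃)) = y₁-blocks a↑e₁ c↑e₃
    tournament (inj₁ (a<b , _))    _               (inj₂ (c<a , _))    (inj₁ (b<c , _))  = <-asym (<-trans c<a a<b) b<c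
    tournament (inj₁ _)            _               (inj₁ (_ , a↑e₂))   (inj₁ (_ , b↑e₃)) = y₂-blocks a↑e₂ b↑e₃
    tournament (inj₁ _)            (inj₁ (_ , a↑e₁)) (inj₁ _)          (inj₂ (_ , c↑e₃)) = y₁-blocks a↑e₁ c↑e₃

module NonGradedExample where

  up : ℕ → List ℕ
  up 0 = 0 ∷ 1 ∷ 2 ∷ 3 ∷ 4 ∷ 5 ∷ 6 ∷ 7 ∷ 8 ∷ []
  up 1 = 1 ∷ 2 ∷ 5 ∷ 6 ∷ 7 ∷ 8 ∷ []
  up 2 = 2 ∷ 6 ∷ 7 ∷ 8 ∷ []
  up 3 = 3 ∷ 4 ∷ 5 ∷ 6 ∷ 7 ∷ 8 ∷ []
  up 4 = 4 ∷ 5 ∷ 6 ∷ 8 ∷ []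
  up 5 = 5 ∷ 6 ∷ 8 ∷ []
  up 6 = 6 ∷ 8 ∷ []
  up 7 = 7 ∷ 8 ∷ []
  up _ = 8 ∷ []

  poset : BoundedFinPoset
  poset = decidedBoundedFinPoset (upSetOrder? 9 up) (# 0) (# 8)

  coverTable : ℕ → List ℕ
  coverTable 0 = 1 ∷ 3 ∷ []
  coverTable 1 = 2 ∷ 5 ∷ []
  coverTable 2 = 6 ∷ 7 ∷ []
  coverTable 3 = 4 ∷ 7 ∷ []
  coverTable 4 = 5 ∷ []
  coverTable 5 = 6 ∷ []
  coverTable 6 = 8 ∷ []
  coverTable 7 = 8 ∷ []
  coverTable _ = []

  enumeration : CoverEnumeration poset
  enumeration = tabulatedCoverEnumeration poset coverTable

  open MaxChainEnumeration poset enumeration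

  coverLabel : ℕ → ℕ → ℕ
  coverLabel 1 2 = 1
  coverLabel 1 5 = 1
  coverLabel 2 6 = 1
  coverLabel 2 7 = 2
  coverLabel 3 7 = 2
  coverLabel _ _ = 0

  labeling : List (Fin 9) → Fin 9 → Fin 9 → ℕ
  labeling _ u v = coverLabel (toℕ u) (toℕ v)

  ccShellable : CCShellable poset 0ℓ 0ℓ 0ℓ
  ccShellable = ℕ.≤-poset , labeling ,
    from-yes (CCLabelingDecision.isCCLabeling? poset enumeration ℕ.≤-poset ℕ._≟_ ℕ._≤?_ labeling)

  notGraded : ¬ Graded poset
  notGraded = from-no graded?

  notCLShellable : NotCLShellable poset
  notCLShellable _ _ _ (Λ , λ' , cl) =
    crossed-pentagons single (from-yes (_⋖?_ poset (# 1) (# 5))) (from-yes (_⋖?_ poset (# 3) (# 7)))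
      (from-yes (maxChainsAre? (# 0) (# 2) [ # 0 ∷ # 1 ∷ # 2 ∷ [] ]))
      (from-yes (maxChainsAre? (# 1) (# 7) [ # 1 ∷ # 2 ∷ # 7 ∷ [] ]))
      (from-yes (maxChainsAre? (# 0) (# 4) [ # 0 ∷ # 3 ∷ # 4 ∷ [] ]))
      (from-yes (maxChainsAre? (# 3) (# 5) [ # 3 ∷ # 4 ∷ # 5 ∷ [] ]))
    where open CLLabelingProperties poset Λ λ' cl

theorem3p1 : CCnotCL Graded ×ω CCnotCL (λ P → ¬ Graded P)
theorem3p1 =
  record { poset       = GradedExample.poset
         ; cond        = GradedExample.graded
         ; ccShellable = GradedExample.ccShellable
         ; notCL       = GradedExample.notCLShellable }
  ,ω
  record { poset       = NonGradedExample.poset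
         ; cond        = NonGradedExample.notGraded
         ; ccShellable = NonGradedExample.ccShellable
         ; notCL       = NonGradedExample.notCLShellable }
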